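{- Let $G=(X,\Gamma)$ be a finite connected undirected graph that is $m$-distance-regular with respect to a partition $\Gamma=\Gamma_1\sqcup\cdots\sqcup\Gamma_m$ and a monomial order $\le$ on $\mathbb{N}^m$. Let $x,y\in X$ with $d_m(x,y)=a$. If $z$ is a vertex on a walk $\xi$ between $x$ and $y$ with $\ell_m(\xi)=a$, then $d_m(x,z)=b$ and $d_m(y,z)=a-b$ for some $b\in\mathbb{N}^m$ with $b_i\le a_i$ for all $i=1,\dots,m$.
   Context: A monomial order on $\mathbb{N}^m$ is a total order $\le$ such that $a\le b$ implies $a+c\le b+c$ for all $c$, and which is a well-ordering. $e_i$ is the $i$-th unit vector. The classes $\Gamma_i$ are nonempty; a walk is a finite sequence of edges $(\gamma_1,\dots,\gamma_L)$, $\gamma_j=(y_j,y_{j+1})$, joining $y_1$ and $y_{L+1}$; its vertices are $y_1,\dots,y_{L+1}$; its $m$-length $\ell_m(\xi)\in\mathbb{N}^m$ has $i$-th coordinate the number of its edges in $\Gamma_i$. The $m$-distance $d_m(x,y)$ is the $\le$-minimum of the $m$-lengths of walks between $x$ and $y$; $\mathcal{D}$ is the set of all $m$-distances. $G$ is $m$-distance-regular w.r.t. the partition and $\le$ if $e_1,\dots,e_m\in\mathcal{D}$ and for all $a,b,c\in\mathcal{D}$ the number of $z$ with $d_m(x,z)=a$, $d_m(z,y)=b$ is the same for all $x,y$ with $d_m(x,y)=c$. -}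

module Defs where

open import Data.Nat using (ℕ; zero; suc; _+_; _∸_; _≤_)
open import Data.Fin using (Fin)
open import Data.Vec using (Vec; zipWith; replicate; lookup; updateAt)
open import Data.Product using (Σ; ∃; _×_; _,_)
open import Data.Empty using (⊥)
open import Relation.Nullary using (¬_)
open import Relation.Binary.PropositionalEquality using (_≡_; _≢_)
open import Relation.Binary.Structures using (IsTotalOrder)
open import Induction.WellFounded using (WellFounded)

ℕ^ : ℕ → Set
ℕ^ m = Vec ℕ m

_⊕_ : ∀ {m} → ℕ^ m → ℕ^ m → ℕ^ m
_⊕_ = zipWith _+_

-- coordinatewise truncated subtraction (used only when b ≤ a coordinatewise)
_⊖_ : ∀ {m} → ℕ^ m → ℕ^ m → ℕ^ m
_⊖_ = zipWith _∸_

𝟎 : ∀ {m} → ℕ^ m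
𝟎 = replicate _ 0

e : ∀ {m} → Fin m → ℕ^ m
e i = updateAt 𝟎 i suc

_≤ᶜ_ : ∀ {m} → ℕ^ m → ℕ^ m → Set
b ≤ᶜ a = ∀ i → lookup b i ≤ lookup a i

record IsMonomialOrder {m} (_≼_ : ℕ^ m → ℕ^ m → Set) : Set₁ where
  field
    isTotalOrder : IsTotalOrder _≡_ _≼_
    compatible   : ∀ a b c → a ≼ b → (a ⊕ c) ≼ (b ⊕ c)
    wellFounded  : WellFounded (λ a b → a ≼ b × a ≢ b)

-- An edge-partitioned graph on vertex set Fin n:
-- Γ i x y means {x,y} is an edge belonging to class Γ_i.
EdgeClasses : ℕ → ℕ → Set₁
EdgeClasses n m = Fin m → Fin n → Fin n → Set

record IsPartitionedGraph {n m} (Γ : EdgeClasses n m) : Set where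
  field
    symmetric   : ∀ i x y → Γ i x y → Γ i y x
    irreflexive : ∀ i x → ¬ Γ i x x
    disjoint    : ∀ i j x y → Γ i x y → Γ j x y → i ≡ j
    nonempty    : ∀ i → Σ (Fin n) λ x → Σ (Fin n) λ y → Γ i x y

data Walk {n m} (Γ : EdgeClasses n m) : Fin n → Fin n → Set where
  []  : ∀ {x} → Walk Γ x x
  _∷_ : ∀ {x y z} → (Σ (Fin m) λ i → Γ i x y) → Walk Γ y z → Walk Γ x z

ℓ : ∀ {n m} {Γ : EdgeClasses n m} {x y} → Walk Γ x y → ℕ^ m
ℓ []             = 𝟎
ℓ ((i , _) ∷ w)  = e i ⊕ ℓ w

data OnWalk {n m} {Γ : EdgeClasses n m} (z : Fin n) : ∀ {x y} → Walk Γ x y → Set where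
  here  : ∀ {x y} {w : Walk Γ x y} → z ≡ x → OnWalk z w
  there : ∀ {x y y'} {s : Σ (Fin m) λ i → Γ i x y'} {w : Walk Γ y' y} →
          OnWalk z w → OnWalk z (s ∷ w)

Connected : ∀ {n m} → EdgeClasses n m → Set
Connected {n} Γ = (x y : Fin n) → Walk Γ x y

IsDist : ∀ {n m} → EdgeClasses n m → (ℕ^ m → ℕ^ m → Set) → Fin n → Fin n → ℕ^ m → Set
IsDist Γ _≼_ x y a =
  (Σ (Walk Γ x y) λ w → ℓ w ≡ a) × (∀ (w : Walk Γ x y) → a ≼ ℓ w)

InD : ∀ {n m} → EdgeClasses n m → (ℕ^ m → ℕ^ m → Set) → ℕ^ m → Set
InD {n} Γ _≼_ a = Σ (Fin n) λ x → Σ (Fin n) λ y → IsDist Γ _≼_ x y a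

HasCard : ∀ {n} → (Fin n → Set) → ℕ → Set
HasCard {n} P k =
  Σ (Fin k → Fin n) λ f →
    (∀ i j → f i ≡ f j → i ≡ j) ×
    (∀ j → P (f j)) ×
    (∀ z → P z → Σ (Fin k) λ j → f j ≡ z)

record IsMDistanceRegular {n m} (Γ : EdgeClasses n m) (_≼_ : ℕ^ m → ℕ^ m → Set) : Set where
  field
    unitsInD : ∀ i → InD Γ _≼_ (e i)
    regular  : ∀ a b c → InD Γ _≼_ a → InD Γ _≼_ b → InD Γ _≼_ c →
               ∀ x y x' y' → IsDist Γ _≼_ x y c → IsDist Γ _≼_ x' y' c →
               Σ ℕ λ k → HasCard (λ z → IsDist Γ _≼_ x z a × IsDist Γ _≼_ z y b) k
                       × HasCard (λ z → IsDist Γ _≼_ x' z a × IsDist Γ _≼_ z y' b) k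

{-# OPTIONS --safe #-}
-- A subwalk of a ≼-minimal walk is itself ≼-minimal: replacing it by a walk
-- of smaller m-length would shorten the whole walk, because a monomial order
-- is preserved by adding a vector and ⊕ is cancellative. Splitting the
-- minimal walk ξ at z, the two halves therefore realise d_m(x,z) and
-- d_m(z,y), and their m-lengths add up to a.
module Submission where

open import Defs
open import Data.Nat.Properties using (+-assoc; +-comm; +-identityˡ; +-cancelʳ-≡; m+n∸m≡n; m≤m+n)
open import Data.Fin using (zero; suc)
open import Data.Vec using ([]; _∷_; head; tail)
open import Data.Vec.Properties using (zipWith-assoc; zipWith-comm; zipWith-identityˡ)
open import Data.Product using (Σ; _×_; _,_)
open import Data.Sum using (inj₁; inj₂)
open import Relation.Binary.PropositionalEquality
open import Relation.Binary.Structures using (IsTotalOrder)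

⊕-assoc : ∀ {m} (a b c : ℕ^ m) → (a ⊕ b) ⊕ c ≡ a ⊕ (b ⊕ c)
⊕-assoc = zipWith-assoc +-assoc

⊕-comm : ∀ {m} (a b : ℕ^ m) → a ⊕ b ≡ b ⊕ a
⊕-comm = zipWith-comm +-comm

⊕-identityˡ : ∀ {m} (a : ℕ^ m) → 𝟎 ⊕ a ≡ a
⊕-identityˡ = zipWith-identityˡ +-identityˡ

⊕-cancelʳ : ∀ {m} (a b c : ℕ^ m) → a ⊕ c ≡ b ⊕ c → a ≡ b
⊕-cancelʳ []      []      []      _  = refl
⊕-cancelʳ (x ∷ a) (y ∷ b) (z ∷ c) eq =
  cong₂ _∷_ (+-cancelʳ-≡ z x y (cong head eq)) (⊕-cancelʳ a b c (cong tail eq))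

⊕-⊖ : ∀ {m} (a b : ℕ^ m) → (a ⊕ b) ⊖ a ≡ b
⊕-⊖ []      []      = refl
⊕-⊖ (x ∷ a) (y ∷ b) = cong₂ _∷_ (m+n∸m≡n x y) (⊕-⊖ a b)

≤ᶜ-⊕ : ∀ {m} (a b : ℕ^ m) → a ≤ᶜ (a ⊕ b)
≤ᶜ-⊕ (x ∷ a) (y ∷ b) zero    = m≤m+n x y
≤ᶜ-⊕ (x ∷ a) (y ∷ b) (suc i) = ≤ᶜ-⊕ a b i

module CompatibleTotalOrder {m} {_≼_ : ℕ^ m → ℕ^ m → Set}
    (isTotalOrder : IsTotalOrder _≡_ _≼_)
    (compatible : ∀ a b c → a ≼ b → (a ⊕ c) ≼ (b ⊕ c)) where

  open IsTotalOrder isTotalOrder using (total; antisym; reflexive)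

  ≼-cancelʳ : ∀ a b c → (a ⊕ c) ≼ (b ⊕ c) → a ≼ b
  ≼-cancelʳ a b c a+c≼b+c with total a b
  ... | inj₁ a≼b = a≼b
  ... | inj₂ b≼a = reflexive (⊕-cancelʳ a b c (antisym a+c≼b+c (compatible b a c b≼a)))

  ≼-cancelˡ : ∀ a b c → (c ⊕ a) ≼ (c ⊕ b) → a ≼ b
  ≼-cancelˡ a b c c+a≼c+b =
    ≼-cancelʳ a b c (subst₂ _≼_ (⊕-comm c a) (⊕-comm c b) c+a≼c+b)

module Walks {n m} {Γ : EdgeClasses n m} where

  infixr 5 _++_

  _++_ : ∀ {x y z} → Walk Γ x y → Walk Γ y z → Walk Γ x z
  []      ++ q = q
  (s ∷ p) ++ q = s ∷ (p ++ q)

  ℓ-++ : ∀ {x y z} (p : Walk Γ x y) (q : Walk Γ y z) → ℓ (p ++ q) ≡ ℓ p ⊕ ℓ q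
  ℓ-++ []            q = sym (⊕-identityˡ (ℓ q))
  ℓ-++ ((i , _) ∷ p) q = trans (cong (e i ⊕_) (ℓ-++ p q)) (sym (⊕-assoc (e i) (ℓ p) (ℓ q)))

  split-at : ∀ {x y} z (ξ : Walk Γ x y) → OnWalk z ξ →
             Σ (Walk Γ x z) λ p → Σ (Walk Γ z y) λ q → p ++ q ≡ ξ
  split-at z ξ       (here refl) = [] , ξ , refl
  split-at z (s ∷ ξ) (there z∈ξ) with split-at z ξ z∈ξ
  ... | p , q , refl = s ∷ p , q , refl

  module Symmetric (symmetric : ∀ i x y → Γ i x y → Γ i y x) where

    reverse : ∀ {x y} → Walk Γ x y → Walk Γ y x
    reverse []            = []
    reverse ((i , g) ∷ p) = reverse p ++ ((i , symmetric i _ _ g) ∷ [])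

    ℓ-reverse : ∀ {x y} (p : Walk Γ x y) → ℓ (reverse p) ≡ ℓ p
    ℓ-reverse [] = refl
    ℓ-reverse ((i , g) ∷ p) = begin
      ℓ (reverse p ++ ((i , symmetric i _ _ g) ∷ [])) ≡⟨ ℓ-++ (reverse p) _ ⟩
      ℓ (reverse p) ⊕ (e i ⊕ 𝟎)                        ≡⟨ cong₂ _⊕_ (ℓ-reverse p) (⊕-comm (e i) 𝟎) ⟩
      ℓ p ⊕ (𝟎 ⊕ e i)                                  ≡⟨ cong (ℓ p ⊕_) (⊕-identityˡ (e i)) ⟩
      ℓ p ⊕ e i                                        ≡⟨ ⊕-comm (ℓ p) (e i) ⟩
      e i ⊕ ℓ p                                        ∎
      where open ≡-Reasoning

open Walks

module Distance {n m} {Γ : EdgeClasses n m} {_≼_ : ℕ^ m → ℕ^ m → Set}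
    (isTotalOrder : IsTotalOrder _≡_ _≼_)
    (compatible : ∀ a b c → a ≼ b → (a ⊕ c) ≼ (b ⊕ c)) where

  open CompatibleTotalOrder isTotalOrder compatible

  IsDist-prefix : ∀ {x y z} (p : Walk Γ x z) (q : Walk Γ z y) →
                  IsDist Γ _≼_ x y (ℓ (p ++ q)) → IsDist Γ _≼_ x z (ℓ p)
  IsDist-prefix p q (_ , minimal) = (p , refl) , λ w →
    ≼-cancelʳ (ℓ p) (ℓ w) (ℓ q) (subst₂ _≼_ (ℓ-++ p q) (ℓ-++ w q) (minimal (w ++ q)))

  IsDist-suffix : ∀ {x y z} (p : Walk Γ x z) (q : Walk Γ z y) →
                  IsDist Γ _≼_ x y (ℓ (p ++ q)) → IsDist Γ _≼_ z y (ℓ q)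
  IsDist-suffix p q (_ , minimal) = (q , refl) , λ w →
    ≼-cancelˡ (ℓ q) (ℓ w) (ℓ p) (subst₂ _≼_ (ℓ-++ p q) (ℓ-++ p w) (minimal (p ++ w)))

  IsDist-sym : (symmetric : ∀ i x y → Γ i x y → Γ i y x) →
               ∀ {x y a} → IsDist Γ _≼_ x y a → IsDist Γ _≼_ y x a
  IsDist-sym symmetric ((p , refl) , minimal) =
    (reverse p , ℓ-reverse p) , λ w → subst (ℓ p ≼_) (ℓ-reverse w) (minimal (reverse w))
    where open Symmetric symmetric

corollary3p9 :
    ∀ {n m} (Γ : EdgeClasses n m) (_≼_ : ℕ^ m → ℕ^ m → Set) →
    IsPartitionedGraph Γ → Connected Γ → IsMonomialOrder _≼_ →
    IsMDistanceRegular Γ _≼_ →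
    ∀ x y a → IsDist Γ _≼_ x y a →
    ∀ (ξ : Walk Γ x y) → ℓ ξ ≡ a →
    ∀ z → OnWalk z ξ →
    Σ (ℕ^ m) λ b → b ≤ᶜ a × IsDist Γ _≼_ x z b × IsDist Γ _≼_ y z (a ⊖ b)
corollary3p9 Γ _≼_ graph _ monomial _ x y _ dist ξ refl z z∈ξ
  with split-at z ξ z∈ξ
... | p , q , refl =
  ℓ p ,
  subst (ℓ p ≤ᶜ_) (sym (ℓ-++ p q)) (≤ᶜ-⊕ (ℓ p) (ℓ q)) ,
  IsDist-prefix p q dist ,
  subst (IsDist Γ _≼_ y z) (sym ℓ-++-⊖) (IsDist-sym symmetric (IsDist-suffix p q dist))
  where
  open IsPartitionedGraph graph using (symmetric)
  open IsMonomialOrder monomial using (isTotalOrder; compatible)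
  open Distance isTotalOrder compatible
  ℓ-++-⊖ : ℓ (p ++ q) ⊖ ℓ p ≡ ℓ q
  ℓ-++-⊖ = trans (cong (_⊖ ℓ p) (ℓ-++ p q)) (⊕-⊖ (ℓ p) (ℓ q))
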